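{- Let $\alpha$ be a word consisting of $m$ letters $x$ and $n$ letters $y$, where $x,y$ satisfy $yx=w(1,1)xy+y$, $x\,w(s,t)=w(s+1,t)\,x$, $y\,w(s,t)=w(s,t+1)\,y$ for all $s,t\in\mathbb{N}$. Then in this algebra \[ \alpha=\sum_{k=0}^{m} f_k(w;B_\alpha)\,x^{m-k}y^{n}. \]
   Context: $(w(s,t))_{s,t\in\mathbb{N}}$ are commuting indeterminates; the algebra is generated by $x,y$ and the $w(s,t)$ subject to the three relations above. The Ferrers board $B_\alpha$ is the set of cells $(i,j)$ (column $i$, row $j$) with $1\le i\le m$, $1\le j\le h_i$, where $h_i$ is the number of $y$'s preceding the $i$-th $x$ in $\alpha$. A file placement of $k$ rooks in $B$ is a $k$-subset $Q\subseteq B$ with no two cells in the same column (several rooks may share a row); $\mathcal{F}_k(B)$ is the set of these. A rook cancels all cells below it in its column; $U_B(Q)$ is the set of cells of $B\setminus Q$ not cancelled by any rook of $Q$. For a cell $(i,j)$, $r_{Q,(i,j)}$ is the number of rooks of $Q$ in its north-west region, i.e. at cells $(i',j')$ with $i'<i$ and $j'\ge j$. The weighted file number is $f_k(w;B)=\sum_{Q\in\mathcal{F}_k(B)}\prod_{(s,t)\in U_B(Q)}w(s-r_{Q,(s,t)},t)$. -}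

module Defs where

open import Level using (Level)
open import Data.Nat using (ℕ; zero; suc; _∸_; _≤ᵇ_)
import Data.Nat as N
open import Data.Bool using (Bool; true; false; if_then_else_)
open import Data.Maybe using (Maybe; just; nothing)
open import Data.List using (List; []; _∷_; map; foldr; upTo; concatMap; filter; length)
open import Algebra.Bundles using (Ring)

data Letter : Set where
  X Y : Letter

Word : Set
Word = List Letter

countX : Word → ℕ
countX []      = 0
countX (X ∷ α) = suc (countX α)
countX (Y ∷ α) = countX α

countY : Word → ℕ
countY []      = 0
countY (X ∷ α) = countY α
countY (Y ∷ α) = suc (countY α)

heightsFrom : ℕ → Word → List ℕ
heightsFrom c []      = []
heightsFrom c (X ∷ α) = c ∷ heightsFrom c α
heightsFrom c (Y ∷ α) = heightsFrom (suc c) α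

heights : Word → List ℕ
heights = heightsFrom 0

rowsFrom : ℕ → ℕ → List ℕ
rowsFrom a len = map (λ i → suc (a N.+ i)) (upTo len)

-- A file placement on the Ferrers board with column heights hs is a list
-- with one entry per column: nothing (no rook in that column) or just j
-- (a rook in row j, 1 ≤ j ≤ h_i).  This is exactly a set of cells with no
-- two in the same column.  'placements hs' enumerates all of them, each once.
Placement : Set
Placement = List (Maybe ℕ)

placements : List ℕ → List Placement
placements []       = [] ∷ []
placements (h ∷ hs) =
  concatMap (λ p → (nothing ∷ p) ∷ map (λ j → just j ∷ p) (rowsFrom 0 h))
            (placements hs)

rookCount : Placement → ℕ
rookCount []            = 0
rookCount (nothing ∷ q) = rookCount q
rookCount (just _ ∷ q)  = suc (rookCount q)

rooksAtOrAbove : ℕ → Placement → ℕ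
rooksAtOrAbove t []            = 0
rooksAtOrAbove t (nothing ∷ q) = rooksAtOrAbove t q
rooksAtOrAbove t (just j ∷ q)  =
  if t ≤ᵇ j then suc (rooksAtOrAbove t q) else rooksAtOrAbove t q

-- Rows of the cells of a column of height h that are neither occupied by
-- the rook of that column nor cancelled by it (a rook cancels the cells
-- below it, i.e. in smaller rows).
uncoveredRows : ℕ → Maybe ℕ → List ℕ
uncoveredRows h nothing  = rowsFrom 0 h
uncoveredRows h (just j) = rowsFrom j (h ∸ j)

module _ {c ℓ : Level} (R : Ring c ℓ) where
  open Ring R

  sumR : List Carrier → Carrier
  sumR = foldr _+_ 0#

  prodR : List Carrier → Carrier
  prodR = foldr _*_ 1#

  pow : Carrier → ℕ → Carrier
  pow a zero    = 1#
  pow a (suc k) = a * pow a k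

  -- product over the uncovered cells (s,t) of w(s - r_{Q,(s,t)}, t),
  -- processing columns s, s+1, … ; 'prev' holds the rooks of columns < s.
  weightFrom : (ℕ → ℕ → Carrier) → ℕ → Placement → List ℕ → Placement → Carrier
  weightFrom w s prev (h ∷ hs) (q ∷ qs) =
    prodR (map (λ t → w (s ∸ rooksAtOrAbove t prev) t) (uncoveredRows h q))
      * weightFrom w (suc s) (q ∷ prev) hs qs
  weightFrom w s prev _ _ = 1#

  weight : (ℕ → ℕ → Carrier) → List ℕ → Placement → Carrier
  weight w hs q = weightFrom w 1 [] hs q

  fileNumber : (ℕ → ℕ → Carrier) → ℕ → List ℕ → Carrier
  fileNumber w k hs =
    sumR (map (weight w hs) (filter (λ q → rookCount q N.≟ k) (placements hs)))

  evalLetter : Carrier → Carrier → Letter → Carrier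
  evalLetter x y X = x
  evalLetter x y Y = y

  evalWord : Carrier → Carrier → Word → Carrier
  evalWord x y []      = 1#
  evalWord x y (l ∷ α) = evalLetter x y l * evalWord x y α

-- Append the letters of α one at a time, keeping the invariant
--   α = Σ_Q weight(Q) · x^(m − #Q) · yⁿ,   Q ranging over the file placements of B_α.
-- Appending y only raises n. Appending x adds a column of height n: by induction
--   yⁿ x = w(1,1)⋯w(1,n) x yⁿ + Σ_j w(1,j+1)⋯w(1,n) yⁿ,
-- one summand for leaving the new column empty and one for a rook in each row j, and pulling this
-- through x^(m − #Q) raises the first index of every w to m − #Q + 1. The paper's weights have first
-- index m + 1 − r instead, r ≤ #Q counting only the rooks to the north-west; the two agree because the
-- relations force w(s+1,t+1) y = w(s,t+1) y, so in front of x^b yⁿ the first index u of w(u,t) is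
-- immaterial as long as u ≥ b. Grouping the placements by their number of rooks gives the file numbers.
module Submission where

open import Defs
open import Data.Nat using (ℕ; zero; suc; _∸_; _≤_; _<_; z≤n; s≤s; _≟_)
open import Data.List using (List; []; _∷_; map; upTo; _++_; _∷ʳ_; _ʳ++_; concatMap; filter; length; applyUpTo)
open import Algebra.Bundles using (Ring)

import Data.Nat as ℕ
import Data.Nat.Properties as ℕₚ
open import Data.Bool using (true; false; if_then_else_)
open import Data.Maybe using (Maybe; just; nothing)
open import Data.List.Properties using (map-∘; map-upTo; map-applyUpTo; map-++)
open import Data.List.Relation.Unary.All as All using (All; []; _∷_)
open import Data.List.Relation.Unary.All.Properties using (map⁺; concat⁺; applyUpTo⁺₂)
open import Data.List.Reverse using (Reverse; reverseView; []; _∶_∶ʳ_)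
open import Relation.Binary.PropositionalEquality as ≡ using (_≡_)
open import Relation.Nullary using (does)
import Relation.Binary.Reasoning.Setoid as SetoidReasoning
import Algebra.Properties.Group as GroupProperties
open import Level using (Level)
open import Function using (_∘_)

countX-∷ʳ-X : ∀ α → countX (α ∷ʳ X) ≡ suc (countX α)
countX-∷ʳ-X []      = ≡.refl
countX-∷ʳ-X (X ∷ α) = ≡.cong suc (countX-∷ʳ-X α)
countX-∷ʳ-X (Y ∷ α) = countX-∷ʳ-X α

countX-∷ʳ-Y : ∀ α → countX (α ∷ʳ Y) ≡ countX α
countX-∷ʳ-Y []      = ≡.refl
countX-∷ʳ-Y (X ∷ α) = ≡.cong suc (countX-∷ʳ-Y α)
countX-∷ʳ-Y (Y ∷ α) = countX-∷ʳ-Y α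

countY-∷ʳ-X : ∀ α → countY (α ∷ʳ X) ≡ countY α
countY-∷ʳ-X []      = ≡.refl
countY-∷ʳ-X (X ∷ α) = countY-∷ʳ-X α
countY-∷ʳ-X (Y ∷ α) = ≡.cong suc (countY-∷ʳ-X α)

countY-∷ʳ-Y : ∀ α → countY (α ∷ʳ Y) ≡ suc (countY α)
countY-∷ʳ-Y []      = ≡.refl
countY-∷ʳ-Y (X ∷ α) = countY-∷ʳ-Y α
countY-∷ʳ-Y (Y ∷ α) = ≡.cong suc (countY-∷ʳ-Y α)

heightsFrom-∷ʳ-X : ∀ c α → heightsFrom c (α ∷ʳ X) ≡ heightsFrom c α ∷ʳ (countY α ℕ.+ c)
heightsFrom-∷ʳ-X c []      = ≡.refl
heightsFrom-∷ʳ-X c (X ∷ α) = ≡.cong (c ∷_) (heightsFrom-∷ʳ-X c α)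
heightsFrom-∷ʳ-X c (Y ∷ α) =
  ≡.trans (heightsFrom-∷ʳ-X (suc c) α) (≡.cong (λ h → heightsFrom (suc c) α ∷ʳ h) (ℕₚ.+-suc (countY α) c))

heightsFrom-∷ʳ-Y : ∀ c α → heightsFrom c (α ∷ʳ Y) ≡ heightsFrom c α
heightsFrom-∷ʳ-Y c []      = ≡.refl
heightsFrom-∷ʳ-Y c (X ∷ α) = ≡.cong (c ∷_) (heightsFrom-∷ʳ-Y c α)
heightsFrom-∷ʳ-Y c (Y ∷ α) = heightsFrom-∷ʳ-Y (suc c) α

heights-∷ʳ-X : ∀ α → heights (α ∷ʳ X) ≡ heights α ∷ʳ countY α
heights-∷ʳ-X α = ≡.trans (heightsFrom-∷ʳ-X 0 α) (≡.cong (heights α ∷ʳ_) (ℕₚ.+-identityʳ (countY α)))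

length-heightsFrom : ∀ c α → length (heightsFrom c α) ≡ countX α
length-heightsFrom c []      = ≡.refl
length-heightsFrom c (X ∷ α) = ≡.cong suc (length-heightsFrom c α)
length-heightsFrom c (Y ∷ α) = length-heightsFrom (suc c) α

rowsFrom-1+ : ∀ n → rowsFrom 0 (suc n) ≡ 1 ∷ rowsFrom 1 n
rowsFrom-1+ n = ≡.cong (1 ∷_) (≡.trans (map-applyUpTo suc suc n) (≡.sym (map-upTo (λ i → suc (suc i)) n)))

map-suc-rowsFrom : ∀ j len → map suc (rowsFrom j len) ≡ rowsFrom (suc j) len
map-suc-rowsFrom j len = ≡.sym (map-∘ (upTo len))

rowsFrom-positive : ∀ j len → All (1 ≤_) (rowsFrom j len)
rowsFrom-positive j len = map⁺ (applyUpTo⁺₂ _ len (λ _ → s≤s z≤n))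

columnChoices : ℕ → List (Maybe ℕ)
columnChoices h = nothing ∷ map just (rowsFrom 0 h)

rookCount≤length : ∀ Q → rookCount Q ≤ length Q
rookCount≤length []           = z≤n
rookCount≤length (nothing ∷ Q) = ℕₚ.m≤n⇒m≤1+n (rookCount≤length Q)
rookCount≤length (just _ ∷ Q)  = s≤s (rookCount≤length Q)

rooksAtOrAbove≤rookCount : ∀ t Q → rooksAtOrAbove t Q ≤ rookCount Q
rooksAtOrAbove≤rookCount t []            = z≤n
rooksAtOrAbove≤rookCount t (nothing ∷ Q) = rooksAtOrAbove≤rookCount t Q
rooksAtOrAbove≤rookCount t (just j ∷ Q) with t ℕ.≤ᵇ j
... | true  = s≤s (rooksAtOrAbove≤rookCount t Q)
... | false = ℕₚ.m≤n⇒m≤1+n (rooksAtOrAbove≤rookCount t Q)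

rookCount-ʳ++ : ∀ Q P → rookCount (Q ʳ++ P) ≡ rookCount Q ℕ.+ rookCount P
rookCount-ʳ++ []            P = ≡.refl
rookCount-ʳ++ (nothing ∷ Q) P = rookCount-ʳ++ Q (nothing ∷ P)
rookCount-ʳ++ (just j ∷ Q)  P = ≡.trans (rookCount-ʳ++ Q (just j ∷ P)) (ℕₚ.+-suc (rookCount Q) (rookCount P))

rookCount-∷ʳ : ∀ Q q → rookCount (Q ∷ʳ q) ≡ rookCount (q ∷ []) ℕ.+ rookCount Q
rookCount-∷ʳ []            q = ≡.sym (ℕₚ.+-identityʳ _)
rookCount-∷ʳ (nothing ∷ Q) q = rookCount-∷ʳ Q q
rookCount-∷ʳ (just _ ∷ Q)  q = ≡.trans (≡.cong suc (rookCount-∷ʳ Q q)) (≡.sym (ℕₚ.+-suc _ (rookCount Q)))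

rooksAtOrAbove-reverse≤rookCount : ∀ t Q → rooksAtOrAbove t (Q ʳ++ []) ≤ rookCount Q
rooksAtOrAbove-reverse≤rookCount t Q = ℕₚ.≤-trans (rooksAtOrAbove≤rookCount t (Q ʳ++ []))
  (ℕₚ.≤-reflexive (≡.trans (rookCount-ʳ++ Q []) (ℕₚ.+-identityʳ (rookCount Q))))

placements-length : ∀ hs → All (λ Q → length Q ≡ length hs) (placements hs)
placements-length []       = ≡.refl ∷ []
placements-length (h ∷ hs) = concat⁺ (map⁺ (All.map extend (placements-length hs)))
  where
  extend : ∀ {p} → length p ≡ length hs →
           All (λ Q → length Q ≡ suc (length hs)) ((nothing ∷ p) ∷ map (λ j → just j ∷ p) (rowsFrom 0 h))
  extend e = ≡.cong suc e ∷ map⁺ (All.universal (λ _ → ≡.cong suc e) (rowsFrom 0 h))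

module _ {c ℓ : Level} (R : Ring c ℓ) where
  open Ring R
  open SetoidReasoning setoid
  open GroupProperties +-group using (∙-cancelˡ)

  sum : List Carrier → Carrier
  sum = sumR R

  prod : List Carrier → Carrier
  prod = prodR R

  infixr 8 _^_
  _^_ : Carrier → ℕ → Carrier
  _^_ = pow R

  sum-congᴬ : ∀ {A : Set} {F G : A → Carrier} {L : List A} → All (λ a → F a ≈ G a) L →
              sum (map F L) ≈ sum (map G L)
  sum-congᴬ []       = refl
  sum-congᴬ (e ∷ es) = +-cong e (sum-congᴬ es)

  sum-cong : ∀ {A : Set} {F G : A → Carrier} (L : List A) → (∀ a → F a ≈ G a) →
             sum (map F L) ≈ sum (map G L)
  sum-cong L e = sum-congᴬ (All.universal e L)

  sum-zero : ∀ {A : Set} (L : List A) → sum (map (λ _ → 0#) L) ≈ 0#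
  sum-zero []      = refl
  sum-zero (_ ∷ L) = trans (+-congˡ (sum-zero L)) (+-identityˡ 0#)

  sum-++ : ∀ (U V : List Carrier) → sum (U ++ V) ≈ sum U + sum V
  sum-++ []      V = sym (+-identityˡ _)
  sum-++ (u ∷ U) V = trans (+-congˡ (sum-++ U V)) (sym (+-assoc u _ _))

  sum-+ : ∀ {A : Set} (F G : A → Carrier) (L : List A) →
          sum (map (λ a → F a + G a) L) ≈ sum (map F L) + sum (map G L)
  sum-+ F G []      = sym (+-identityˡ 0#)
  sum-+ F G (a ∷ L) = begin
    (F a + G a) + sum (map (λ a → F a + G a) L) ≈⟨ +-congˡ (sum-+ F G L) ⟩
    (F a + G a) + (ΣF + ΣG)                      ≈⟨ +-assoc _ _ _ ⟩
    F a + (G a + (ΣF + ΣG))                      ≈⟨ +-congˡ (sym (+-assoc _ _ _)) ⟩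
    F a + ((G a + ΣF) + ΣG)                      ≈⟨ +-congˡ (+-congʳ (+-comm _ _)) ⟩
    F a + ((ΣF + G a) + ΣG)                      ≈⟨ +-congˡ (+-assoc _ _ _) ⟩
    F a + (ΣF + (G a + ΣG))                      ≈⟨ sym (+-assoc _ _ _) ⟩
    (F a + ΣF) + (G a + ΣG)                      ∎
    where
    ΣF = sum (map F L)
    ΣG = sum (map G L)

  sum-distribˡ : ∀ {A : Set} (k : Carrier) (F : A → Carrier) (L : List A) →
                 k * sum (map F L) ≈ sum (map (λ a → k * F a) L)
  sum-distribˡ k F []      = zeroʳ k
  sum-distribˡ k F (a ∷ L) = trans (distribˡ k (F a) _) (+-congˡ (sum-distribˡ k F L))

  sum-distribʳ : ∀ {A : Set} (k : Carrier) (F : A → Carrier) (L : List A) →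
                 sum (map F L) * k ≈ sum (map (λ a → F a * k) L)
  sum-distribʳ k F []      = zeroˡ k
  sum-distribʳ k F (a ∷ L) = trans (distribʳ k (F a) _) (+-congˡ (sum-distribʳ k F L))

  sum-concatMap : ∀ {A B : Set} (F : B → Carrier) (g : A → List B) (L : List A) →
                  sum (map F (concatMap g L)) ≈ sum (map (λ a → sum (map F (g a))) L)
  sum-concatMap F g []      = refl
  sum-concatMap F g (a ∷ L) = begin
    sum (map F (g a ++ concatMap g L))              ≡⟨ ≡.cong sum (map-++ F (g a) (concatMap g L)) ⟩
    sum (map F (g a) ++ map F (concatMap g L))      ≈⟨ sum-++ (map F (g a)) _ ⟩
    sum (map F (g a)) + sum (map F (concatMap g L)) ≈⟨ +-congˡ (sum-concatMap F g L) ⟩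
    sum (map (λ a → sum (map F (g a))) (a ∷ L))     ∎

  sum-swap : ∀ {A B : Set} (F : A → B → Carrier) (U : List A) (V : List B) →
             sum (map (λ a → sum (map (F a) V)) U) ≈ sum (map (λ b → sum (map (λ a → F a b) U)) V)
  sum-swap F []      V = sym (sum-zero V)
  sum-swap F (a ∷ U) V =
    trans (+-congˡ (sum-swap F U V)) (sym (sum-+ (F a) (λ b → sum (map (λ a → F a b) U)) V))

  sum-indicator : ∀ r m (a : Carrier) (C : ℕ → Carrier) → r < m →
    sum (applyUpTo (λ k → (if does (r ≟ k) then a else 0#) * C k) m) ≈ a * C r
  sum-indicator zero    (suc m) a C _ = begin
    a * C 0 + sum (applyUpTo (λ k → 0# * C (suc k)) m) ≡⟨ ≡.cong (λ L → a * C 0 + sum L) (≡.sym (map-upTo _ m)) ⟩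
    a * C 0 + sum (map (λ k → 0# * C (suc k)) (upTo m)) ≈⟨ +-congˡ (sum-cong (upTo m) (λ k → zeroˡ (C (suc k)))) ⟩
    a * C 0 + sum (map (λ _ → 0#) (upTo m))             ≈⟨ +-congˡ (sum-zero (upTo m)) ⟩
    a * C 0 + 0#                                        ≈⟨ +-identityʳ _ ⟩
    a * C 0                                             ∎
  sum-indicator (suc r) (suc m) a C (s≤s r<m) =
    trans (+-cong (zeroˡ (C 0)) (sum-indicator r m a (λ k → C (suc k)) r<m)) (+-identityˡ _)

  sum-by-key : ∀ {A : Set} (κ : A → ℕ) (F : A → Carrier) (C : ℕ → Carrier) m (L : List A) →
    All (λ a → κ a < m) L →
    sum (map (λ k → sum (map F (filter (λ a → κ a ≟ k) L)) * C k) (upTo m)) ≈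
    sum (map (λ a → F a * C (κ a)) L)
  sum-by-key κ F C m []      []               = trans (sum-cong (upTo m) (λ k → zeroˡ (C k))) (sum-zero (upTo m))
  sum-by-key κ F C m (a ∷ L) (κa<m ∷ bounds) = begin
    sum (map (λ k → S (a ∷ L) k * C k) (upTo m))
      ≈⟨ sum-cong (upTo m) (λ k → trans (*-congʳ (S-∷ k)) (distribʳ (C k) (δ k) (S L k))) ⟩
    sum (map (λ k → δ k * C k + S L k * C k) (upTo m))
      ≈⟨ sum-+ (λ k → δ k * C k) (λ k → S L k * C k) (upTo m) ⟩
    sum (map (λ k → δ k * C k) (upTo m)) + sum (map (λ k → S L k * C k) (upTo m))
      ≈⟨ +-cong δ-sum (sum-by-key κ F C m L bounds) ⟩
    F a * C (κ a) + sum (map (λ a → F a * C (κ a)) L) ∎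
    where
    S : List _ → ℕ → Carrier
    S L k = sum (map F (filter (λ a → κ a ≟ k) L))
    δ : ℕ → Carrier
    δ k = if does (κ a ≟ k) then F a else 0#
    S-∷ : ∀ k → S (a ∷ L) k ≈ δ k + S L k
    S-∷ k with does (κ a ≟ k)
    ... | true  = refl
    ... | false = sym (+-identityˡ _)
    δ-sum : sum (map (λ k → δ k * C k) (upTo m)) ≈ F a * C (κ a)
    δ-sum = trans (reflexive (≡.cong sum (map-upTo _ m))) (sum-indicator (κ a) m (F a) C κa<m)

  prod-commute : ∀ {A : Set} (z : Carrier) (f g : A → Carrier) (L : List A) → (∀ a → z * f a ≈ g a * z) →
                 z * prod (map f L) ≈ prod (map g L) * z
  prod-commute z f g []      _ = trans (*-identityʳ z) (sym (*-identityˡ z))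
  prod-commute z f g (a ∷ L) e = begin
    z * (f a * prod (map f L)) ≈⟨ sym (*-assoc _ _ _) ⟩
    (z * f a) * prod (map f L) ≈⟨ *-congʳ (e a) ⟩
    (g a * z) * prod (map f L) ≈⟨ *-assoc _ _ _ ⟩
    g a * (z * prod (map f L)) ≈⟨ *-congˡ (prod-commute z f g L e) ⟩
    g a * (prod (map g L) * z) ≈⟨ sym (*-assoc _ _ _) ⟩
    (g a * prod (map g L)) * z ∎

  pow-sucʳ : ∀ a n → a ^ suc n ≈ a ^ n * a
  pow-sucʳ a zero    = trans (*-identityʳ a) (sym (*-identityˡ a))
  pow-sucʳ a (suc n) = trans (*-congˡ (pow-sucʳ a n)) (sym (*-assoc a (a ^ n) a))

  pow-commute : ∀ (z : Carrier) (f : ℕ → Carrier) → (∀ s → z * f s ≈ f (suc s) * z) →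
                ∀ a s → z ^ a * f s ≈ f (a ℕ.+ s) * z ^ a
  pow-commute z f e zero    s = trans (*-identityˡ _) (sym (*-identityʳ _))
  pow-commute z f e (suc a) s = begin
    (z * z ^ a) * f s         ≈⟨ *-assoc _ _ _ ⟩
    z * (z ^ a * f s)         ≈⟨ *-congˡ (pow-commute z f e a s) ⟩
    z * (f (a ℕ.+ s) * z ^ a) ≈⟨ sym (*-assoc _ _ _) ⟩
    (z * f (a ℕ.+ s)) * z ^ a ≈⟨ *-congʳ (e (a ℕ.+ s)) ⟩
    (f (suc a ℕ.+ s) * z) * z ^ a ≈⟨ *-assoc _ _ _ ⟩
    f (suc a ℕ.+ s) * (z * z ^ a) ∎

  sum-placements-∷ : ∀ h hs (F : Placement → Carrier) →
    sum (map F (placements (h ∷ hs))) ≈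
    sum (map (λ P → sum (map (λ q → F (q ∷ P)) (columnChoices h))) (placements hs))
  sum-placements-∷ h hs F = trans (sum-concatMap F _ (placements hs))
    (sum-cong (placements hs) (λ P → +-congˡ (reflexive (≡.cong sum
      (≡.trans (≡.sym (map-∘ (rowsFrom 0 h))) (map-∘ (rowsFrom 0 h)))))))

  sum-placements-∷ʳ : ∀ h hs (F : Placement → Carrier) →
    sum (map F (placements (hs ∷ʳ h))) ≈
    sum (map (λ Q → sum (map (λ q → F (Q ∷ʳ q)) (columnChoices h))) (placements hs))
  sum-placements-∷ʳ h []        F = sum-placements-∷ h [] F
  sum-placements-∷ʳ h (h₀ ∷ hs) F = begin
    sum (map F (placements (h₀ ∷ hs ∷ʳ h)))
      ≈⟨ sum-placements-∷ h₀ (hs ∷ʳ h) F ⟩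
    sum (map (λ P → sum (map (λ q₀ → F (q₀ ∷ P)) (columnChoices h₀))) (placements (hs ∷ʳ h)))
      ≈⟨ sum-placements-∷ʳ h hs _ ⟩
    sum (map (λ Q → sum (map (λ q → sum (map (λ q₀ → F (q₀ ∷ Q ∷ʳ q)) (columnChoices h₀))) (columnChoices h)))
             (placements hs))
      ≈⟨ sum-cong (placements hs) (λ Q → sym (sum-swap (λ q₀ q → F (q₀ ∷ Q ∷ʳ q)) (columnChoices h₀) (columnChoices h))) ⟩
    sum (map (λ Q → sum (map (λ q₀ → sum (map (λ q → F (q₀ ∷ Q ∷ʳ q)) (columnChoices h))) (columnChoices h₀)))
             (placements hs))
      ≈⟨ sym (sum-placements-∷ h₀ hs _) ⟩
    sum (map (λ Q → sum (map (λ q → F (Q ∷ʳ q)) (columnChoices h))) (placements (h₀ ∷ hs))) ∎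

  module _ (w : ℕ → ℕ → Carrier) where

    columnWeight : ℕ → (ℕ → ℕ) → ℕ → Maybe ℕ → Carrier
    columnWeight s r h q = prod (map (λ t → w (s ∸ r t) t) (uncoveredRows h q))

    weightFrom-∷ʳ : ∀ h q s prev hs Q → length Q ≡ length hs →
      weightFrom R w s prev (hs ∷ʳ h) (Q ∷ʳ q) ≈
      weightFrom R w s prev hs Q * columnWeight (s ℕ.+ length hs) (λ t → rooksAtOrAbove t (Q ʳ++ prev)) h q
    weightFrom-∷ʳ h q s prev []        []        _   rewrite ℕₚ.+-identityʳ s =
      trans (*-identityʳ _) (sym (*-identityˡ _))
    weightFrom-∷ʳ h q s prev (h₀ ∷ hs) (q₀ ∷ Q) len = begin
      column₀ * weightFrom R w (suc s) (q₀ ∷ prev) (hs ∷ʳ h) (Q ∷ʳ q)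
        ≈⟨ *-congˡ (weightFrom-∷ʳ h q (suc s) (q₀ ∷ prev) hs Q (ℕₚ.suc-injective len)) ⟩
      column₀ * (weightFrom R w (suc s) (q₀ ∷ prev) hs Q * columnWeight (suc s ℕ.+ length hs) r h q)
        ≈⟨ sym (*-assoc _ _ _) ⟩
      (column₀ * weightFrom R w (suc s) (q₀ ∷ prev) hs Q) * columnWeight (suc s ℕ.+ length hs) r h q
        ≡⟨ ≡.cong (λ i → column₀ * weightFrom R w (suc s) (q₀ ∷ prev) hs Q * columnWeight i r h q) (≡.sym (ℕₚ.+-suc s (length hs))) ⟩
      (column₀ * weightFrom R w (suc s) (q₀ ∷ prev) hs Q) * columnWeight (s ℕ.+ suc (length hs)) r h q ∎
      where
      column₀ = columnWeight s (λ t → rooksAtOrAbove t prev) h₀ q₀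
      r : ℕ → ℕ
      r t = rooksAtOrAbove t (Q ʳ++ (q₀ ∷ prev))

  evalWord-∷ʳ : ∀ x y α l → evalWord R x y (α ∷ʳ l) ≈ evalWord R x y α * evalLetter R x y l
  evalWord-∷ʳ x y []      l = trans (*-identityʳ _) (sym (*-identityˡ _))
  evalWord-∷ʳ x y (l₀ ∷ α) l = trans (*-congˡ (evalWord-∷ʳ x y α l)) (sym (*-assoc _ _ _))

  module Normalisation (x y : Carrier) (w : ℕ → ℕ → Carrier)
           (w-comm : ∀ s t s′ t′ → w s t * w s′ t′ ≈ w s′ t′ * w s t)
           (y*x : y * x ≈ w 1 1 * x * y + y)
           (x*w : ∀ s t → x * w s t ≈ w (suc s) t * x)
           (y*w : ∀ s t → y * w s t ≈ w s (suc t) * y) where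

    xᵃ*prod : ∀ a s (L : List ℕ) Z → x ^ a * (prod (map (w s) L) * Z) ≈ prod (map (w (a ℕ.+ s)) L) * (x ^ a * Z)
    xᵃ*prod a s L Z = begin
      x ^ a * (prod (map (w s) L) * Z)         ≈⟨ sym (*-assoc _ _ _) ⟩
      x ^ a * prod (map (w s) L) * Z           ≈⟨ *-congʳ (prod-commute (x ^ a) (w s) (w (a ℕ.+ s)) L
                                                    (λ t → pow-commute x (λ s → w s t) (λ s → x*w s t) a s)) ⟩
      prod (map (w (a ℕ.+ s)) L) * x ^ a * Z   ≈⟨ *-assoc _ _ _ ⟩
      prod (map (w (a ℕ.+ s)) L) * (x ^ a * Z) ∎

    y*prod-rowsFrom : ∀ s j len → y * prod (map (w s) (rowsFrom j len)) ≈ prod (map (w s) (rowsFrom (suc j) len)) * y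
    y*prod-rowsFrom s j len = trans (prod-commute y (w s) (λ t → w s (suc t)) (rowsFrom j len) (y*w s))
      (reflexive (≡.cong (λ L → prod L * y) (≡.trans (map-∘ (rowsFrom j len)) (≡.cong (map (w s)) (map-suc-rowsFrom j len)))))

    w*prod : ∀ s t (f : ℕ → ℕ) (L : List ℕ) →
             w s t * prod (map (λ u → w (f u) u) L) ≈ prod (map (λ u → w (f u) u) L) * w s t
    w*prod s t f L = prod-commute (w s t) _ _ L (λ u → w-comm s t (f u) u)

    -- Expanding (y x) w(s,t) in the two possible orders and cancelling the common term.
    w-suc*y : ∀ s t → w (suc s) (suc t) * y ≈ w s (suc t) * y
    w-suc*y s t = ∙-cancelˡ (w 1 1 * W * x * y) (W * y) (V * y) (trans (sym viaW) viaV)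
      where
      W = w (suc s) (suc t)
      V = w s (suc t)
      viaW : (y * x) * w s t ≈ w 1 1 * W * x * y + W * y
      viaW = begin
        (y * x) * w s t            ≈⟨ *-assoc _ _ _ ⟩
        y * (x * w s t)            ≈⟨ *-congˡ (x*w s t) ⟩
        y * (w (suc s) t * x)      ≈⟨ sym (*-assoc _ _ _) ⟩
        (y * w (suc s) t) * x      ≈⟨ *-congʳ (y*w (suc s) t) ⟩
        (W * y) * x                ≈⟨ *-assoc _ _ _ ⟩
        W * (y * x)                ≈⟨ *-congˡ y*x ⟩
        W * (w 1 1 * x * y + y)    ≈⟨ distribˡ _ _ _ ⟩
        W * (w 1 1 * x * y) + W * y ≈⟨ +-congʳ (trans (sym (*-assoc _ _ _)) (*-congʳ (sym (*-assoc _ _ _)))) ⟩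
        W * w 1 1 * x * y + W * y  ≈⟨ +-congʳ (*-congʳ (*-congʳ (w-comm _ _ 1 1))) ⟩
        w 1 1 * W * x * y + W * y  ∎
      viaV : (y * x) * w s t ≈ w 1 1 * W * x * y + V * y
      viaV = begin
        (y * x) * w s t                     ≈⟨ *-congʳ y*x ⟩
        (w 1 1 * x * y + y) * w s t         ≈⟨ distribʳ _ _ _ ⟩
        w 1 1 * x * y * w s t + y * w s t   ≈⟨ +-cong (*-assoc _ _ _) (y*w s t) ⟩
        w 1 1 * x * (y * w s t) + V * y     ≈⟨ +-congʳ (*-congˡ (y*w s t)) ⟩
        w 1 1 * x * (V * y) + V * y         ≈⟨ +-congʳ (sym (*-assoc _ _ _)) ⟩
        w 1 1 * x * V * y + V * y           ≈⟨ +-congʳ (*-congʳ (*-assoc _ _ _)) ⟩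
        w 1 1 * (x * V) * y + V * y         ≈⟨ +-congʳ (*-congʳ (*-congˡ (x*w s (suc t)))) ⟩
        w 1 1 * (W * x) * y + V * y         ≈⟨ +-congʳ (*-congʳ (sym (*-assoc _ _ _))) ⟩
        w 1 1 * W * x * y + V * y           ∎

    w*y-irrelevant : ∀ u u′ t → w u (suc t) * y ≈ w u′ (suc t) * y
    w*y-irrelevant u u′ t = trans (to-0 u) (sym (to-0 u′))
      where
      to-0 : ∀ u → w u (suc t) * y ≈ w 0 (suc t) * y
      to-0 zero    = refl
      to-0 (suc u) = trans (w-suc*y u t) (to-0 u)

    w*xᵇyⁿ⁺¹-irrelevant : ∀ {b u u′ t} n → 1 ≤ t → b ≤ u → b ≤ u′ →
      w u t * (x ^ b * y ^ suc n) ≈ w u′ t * (x ^ b * y ^ suc n)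
    w*xᵇyⁿ⁺¹-irrelevant {b} {u} {u′} {suc t} n (s≤s z≤n) b≤u b≤u′ = begin
      w u (suc t) * Z                     ≡⟨ ≡.cong (λ v → w v (suc t) * Z) (≡.sym (ℕₚ.m+[n∸m]≡n b≤u)) ⟩
      w (b ℕ.+ (u ∸ b)) (suc t) * Z       ≈⟨ past-xᵇ (u ∸ b) ⟩
      x ^ b * (w (u ∸ b) (suc t) * y ^ suc n)  ≈⟨ *-congˡ (w*yⁿ⁺¹-irrelevant (u ∸ b) (u′ ∸ b)) ⟩
      x ^ b * (w (u′ ∸ b) (suc t) * y ^ suc n) ≈⟨ sym (past-xᵇ (u′ ∸ b)) ⟩
      w (b ℕ.+ (u′ ∸ b)) (suc t) * Z      ≡⟨ ≡.cong (λ v → w v (suc t) * Z) (ℕₚ.m+[n∸m]≡n b≤u′) ⟩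
      w u′ (suc t) * Z                    ∎
      where
      Z = x ^ b * y ^ suc n
      past-xᵇ : ∀ c → w (b ℕ.+ c) (suc t) * Z ≈ x ^ b * (w c (suc t) * y ^ suc n)
      past-xᵇ c = begin
        w (b ℕ.+ c) (suc t) * (x ^ b * y ^ suc n) ≈⟨ sym (*-assoc _ _ _) ⟩
        (w (b ℕ.+ c) (suc t) * x ^ b) * y ^ suc n ≈⟨ *-congʳ (sym (pow-commute x (λ s → w s (suc t)) (λ s → x*w s (suc t)) b c)) ⟩
        (x ^ b * w c (suc t)) * y ^ suc n         ≈⟨ *-assoc _ _ _ ⟩
        x ^ b * (w c (suc t) * y ^ suc n)         ∎
      w*yⁿ⁺¹-irrelevant : ∀ v v′ → w v (suc t) * y ^ suc n ≈ w v′ (suc t) * y ^ suc n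
      w*yⁿ⁺¹-irrelevant v v′ = begin
        w v (suc t) * (y * y ^ n)   ≈⟨ sym (*-assoc _ _ _) ⟩
        (w v (suc t) * y) * y ^ n   ≈⟨ *-congʳ (w*y-irrelevant v v′ t) ⟩
        (w v′ (suc t) * y) * y ^ n  ≈⟨ *-assoc _ _ _ ⟩
        w v′ (suc t) * (y * y ^ n)  ∎

    prod-w-cong : ∀ (f g : ℕ → ℕ) (Z : Carrier) (L : List ℕ) → All (λ t → w (f t) t * Z ≈ w (g t) t * Z) L →
      prod (map (λ t → w (f t) t) L) * Z ≈ prod (map (λ t → w (g t) t) L) * Z
    prod-w-cong f g Z []      []       = refl
    prod-w-cong f g Z (t ∷ L) (e ∷ es) = begin
      (w (f t) t * Πf) * Z ≈⟨ *-assoc _ _ _ ⟩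
      w (f t) t * (Πf * Z) ≈⟨ *-congˡ (prod-w-cong f g Z L es) ⟩
      w (f t) t * (Πg * Z) ≈⟨ sym (*-assoc _ _ _) ⟩
      (w (f t) t * Πg) * Z ≈⟨ *-congʳ (w*prod (f t) t g L) ⟩
      (Πg * w (f t) t) * Z ≈⟨ *-assoc _ _ _ ⟩
      Πg * (w (f t) t * Z) ≈⟨ *-congˡ e ⟩
      Πg * (w (g t) t * Z) ≈⟨ sym (*-assoc _ _ _) ⟩
      (Πg * w (g t) t) * Z ≈⟨ *-congʳ (sym (w*prod (g t) t g L)) ⟩
      (w (g t) t * Πg) * Z ∎
      where
      Πf = prod (map (λ t → w (f t) t) L)
      Πg = prod (map (λ t → w (g t) t) L)

    prod-rowsFrom-irrelevant : ∀ {b n len} j (f g : ℕ → ℕ) → len ≤ n → (∀ t → b ≤ f t) → (∀ t → b ≤ g t) →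
      prod (map (λ t → w (f t) t) (rowsFrom j len)) * (x ^ b * y ^ n) ≈
      prod (map (λ t → w (g t) t) (rowsFrom j len)) * (x ^ b * y ^ n)
    prod-rowsFrom-irrelevant {n = zero}          j f g z≤n _   _   = refl
    prod-rowsFrom-irrelevant {n = suc n} {len} j f g _   b≤f b≤g =
      prod-w-cong f g _ (rowsFrom j len)
        (All.map (λ 1≤t → w*xᵇyⁿ⁺¹-irrelevant n 1≤t (b≤f _) (b≤g _)) (rowsFrom-positive j len))

    y*prod-x : ∀ j len Z →
      y * (prod (map (w 1) (rowsFrom j len)) * x * Z) ≈
      w 1 1 * prod (map (w 1) (rowsFrom (suc j) len)) * x * (y * Z) + prod (map (w 1) (rowsFrom (suc j) len)) * (y * Z)
    y*prod-x j len Z = begin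
      y * (Π * x * Z)                      ≈⟨ trans (sym (*-assoc _ _ _)) (*-congʳ (sym (*-assoc _ _ _))) ⟩
      y * Π * x * Z                        ≈⟨ *-congʳ (*-congʳ (y*prod-rowsFrom 1 j len)) ⟩
      Π′ * y * x * Z                       ≈⟨ *-congʳ (*-assoc _ _ _) ⟩
      Π′ * (y * x) * Z                     ≈⟨ *-congʳ (*-congˡ y*x) ⟩
      Π′ * (w 1 1 * x * y + y) * Z         ≈⟨ trans (*-congʳ (distribˡ _ _ _)) (distribʳ _ _ _) ⟩
      Π′ * (w 1 1 * x * y) * Z + Π′ * y * Z ≈⟨ +-cong reassoc (*-assoc _ _ _) ⟩
      Π′ * w 1 1 * x * (y * Z) + Π′ * (y * Z) ≈⟨ +-congʳ (*-congʳ (*-congʳ (sym (w*prod 1 1 (λ _ → 1) (rowsFrom (suc j) len))))) ⟩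
      w 1 1 * Π′ * x * (y * Z) + Π′ * (y * Z) ∎
      where
      Π  = prod (map (w 1) (rowsFrom j len))
      Π′ = prod (map (w 1) (rowsFrom (suc j) len))
      reassoc : Π′ * (w 1 1 * x * y) * Z ≈ Π′ * w 1 1 * x * (y * Z)
      reassoc = begin
        Π′ * (w 1 1 * x * y) * Z   ≈⟨ *-congʳ (sym (*-assoc _ _ _)) ⟩
        Π′ * (w 1 1 * x) * y * Z   ≈⟨ *-assoc _ _ _ ⟩
        Π′ * (w 1 1 * x) * (y * Z) ≈⟨ *-congʳ (sym (*-assoc _ _ _)) ⟩
        Π′ * w 1 1 * x * (y * Z)   ∎

    yⁿ*x : ∀ n → y ^ n * x ≈ prod (map (w 1) (rowsFrom 0 n)) * x * y ^ n
                           + sum (map (λ j → prod (map (w 1) (rowsFrom j (n ∸ j))) * y ^ n) (rowsFrom 0 n))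
    yⁿ*x zero    = trans (sym (*-identityʳ _)) (sym (+-identityʳ _))
    yⁿ*x (suc n) = begin
      y * y ^ n * x                                                 ≈⟨ *-assoc _ _ _ ⟩
      y * (y ^ n * x)                                               ≈⟨ *-congˡ (yⁿ*x n) ⟩
      y * (prod (map (w 1) R₀) * x * y ^ n + Σ)                     ≈⟨ distribˡ _ _ _ ⟩
      y * (prod (map (w 1) R₀) * x * y ^ n) + y * Σ                 ≈⟨ +-cong (y*prod-x 0 n (y ^ n)) y*Σ ⟩
      (w 1 1 * Π₁ * x * y ^ suc n + G 1) + sum (map (G ∘ suc) R₀)   ≈⟨ +-assoc _ _ _ ⟩
      w 1 1 * Π₁ * x * y ^ suc n + (G 1 + sum (map (G ∘ suc) R₀))   ≡⟨ ≡.cong (λ L → w 1 1 * Π₁ * x * y ^ suc n + (G 1 + sum L))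
                                                                         (≡.trans (map-∘ R₀) (≡.cong (map G) (map-suc-rowsFrom 0 n))) ⟩
      w 1 1 * Π₁ * x * y ^ suc n + sum (map G (1 ∷ rowsFrom 1 n))   ≡⟨ ≡.cong (λ L → prod (map (w 1) L) * x * y ^ suc n + sum (map G L))
                                                                         (≡.sym (rowsFrom-1+ n)) ⟩
      prod (map (w 1) (rowsFrom 0 (suc n))) * x * y ^ suc n + sum (map G (rowsFrom 0 (suc n))) ∎
      where
      R₀ = rowsFrom 0 n
      Π₁ = prod (map (w 1) (rowsFrom 1 n))
      Σ  = sum (map (λ j → prod (map (w 1) (rowsFrom j (n ∸ j))) * y ^ n) R₀)
      G : ℕ → Carrier
      G j = prod (map (w 1) (rowsFrom j (suc n ∸ j))) * y ^ suc n
      y*Σ : y * Σ ≈ sum (map (G ∘ suc) R₀)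
      y*Σ = trans (sum-distribˡ y _ R₀) (sum-cong R₀ (λ j →
        trans (sym (*-assoc _ _ _)) (trans (*-congʳ (y*prod-rowsFrom 1 j (n ∸ j))) (*-assoc _ _ _))))

    -- The exponent is written rookCount (q ∷ []) ℕ.+ k so that it computes for each concrete q.
    x*column : ∀ {m k} (r : ℕ → ℕ) n → k ≤ m → (∀ t → r t ≤ k) →
      x ^ (m ∸ k) * y ^ n * x ≈
      sum (map (λ q → columnWeight w (suc m) r n q * (x ^ (suc m ∸ (rookCount (q ∷ []) ℕ.+ k)) * y ^ n))
               (columnChoices n))
    x*column {m} {k} r n k≤m r≤k = begin
      x ^ a * y ^ n * x                                   ≈⟨ *-assoc _ _ _ ⟩
      x ^ a * (y ^ n * x)                                 ≈⟨ *-congˡ (yⁿ*x n) ⟩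
      x ^ a * (Π₀ * x * y ^ n + Σ)                        ≈⟨ distribˡ _ _ _ ⟩
      x ^ a * (Π₀ * x * y ^ n) + x ^ a * Σ                ≈⟨ +-cong no-rook (trans (sum-distribˡ (x ^ a) _ R₀)
                                                               (sum-cong R₀ rook-in)) ⟩
      H nothing + sum (map (λ j → H (just j)) R₀)         ≡⟨ ≡.cong (λ L → H nothing + sum L) (map-∘ R₀) ⟩
      sum (map H (columnChoices n))                       ∎
      where
      a  = m ∸ k
      R₀ = rowsFrom 0 n
      Π₀ = prod (map (w 1) R₀)
      Σ  = sum (map (λ j → prod (map (w 1) (rowsFrom j (n ∸ j))) * y ^ n) R₀)
      H : Maybe ℕ → Carrier
      H q = columnWeight w (suc m) r n q * (x ^ (suc m ∸ (rookCount (q ∷ []) ℕ.+ k)) * y ^ n)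
      1+a≡ : suc m ∸ k ≡ suc a
      1+a≡ = ℕₚ.+-∸-assoc 1 k≤m
      1+a≤ : ∀ t → suc a ≤ suc m ∸ r t
      1+a≤ t = ℕₚ.≤-trans (ℕₚ.≤-reflexive (≡.sym 1+a≡)) (ℕₚ.∸-monoʳ-≤ (suc m) (r≤k t))
      no-rook : x ^ a * (Π₀ * x * y ^ n) ≈ H nothing
      no-rook = begin
        x ^ a * (Π₀ * x * y ^ n)                          ≈⟨ *-congˡ (*-assoc _ _ _) ⟩
        x ^ a * (Π₀ * (x * y ^ n))                        ≈⟨ xᵃ*prod a 1 R₀ _ ⟩
        prod (map (w (a ℕ.+ 1)) R₀) * (x ^ a * (x * y ^ n)) ≈⟨ *-congˡ (trans (sym (*-assoc _ _ _))
                                                                 (*-congʳ (sym (pow-sucʳ x a)))) ⟩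
        prod (map (w (a ℕ.+ 1)) R₀) * (x ^ suc a * y ^ n)
          ≈⟨ prod-rowsFrom-irrelevant {n = n} 0 (λ _ → a ℕ.+ 1) (λ t → suc m ∸ r t) ℕₚ.≤-refl
               (λ _ → ℕₚ.≤-reflexive (ℕₚ.+-comm 1 a)) 1+a≤ ⟩
        columnWeight w (suc m) r n nothing * (x ^ suc a * y ^ n)
          ≡⟨ ≡.cong (λ e → columnWeight w (suc m) r n nothing * (x ^ e * y ^ n)) (≡.sym 1+a≡) ⟩
        H nothing ∎
      rook-in : ∀ j → x ^ a * (prod (map (w 1) (rowsFrom j (n ∸ j))) * y ^ n) ≈ H (just j)
      rook-in j = trans (xᵃ*prod a 1 (rowsFrom j (n ∸ j)) _)
        (prod-rowsFrom-irrelevant {n = n} j (λ _ → a ℕ.+ 1) (λ t → suc m ∸ r t) (ℕₚ.m∸n≤m n j)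
           (λ _ → ℕₚ.m≤m+n a 1) (λ t → ℕₚ.≤-trans (ℕₚ.n≤1+n a) (1+a≤ t)))

    normalForm : List ℕ → ℕ → ℕ → Carrier
    normalForm hs m n = sum (map (λ Q → weight R w hs Q * (x ^ (m ∸ rookCount Q) * y ^ n)) (placements hs))

    normalForm-*y : ∀ hs m n → normalForm hs m n * y ≈ normalForm hs m (suc n)
    normalForm-*y hs m n = trans (sum-distribʳ y _ (placements hs)) (sum-cong (placements hs) (λ Q →
      trans (*-assoc _ _ _) (*-congˡ (trans (*-assoc _ _ _) (*-congˡ (sym (pow-sucʳ y n)))))))

    placement-*x : ∀ hs n Q → length Q ≡ length hs →
      weight R w hs Q * (x ^ (length hs ∸ rookCount Q) * y ^ n) * x ≈
      sum (map (λ q → weight R w (hs ∷ʳ n) (Q ∷ʳ q) * (x ^ (suc (length hs) ∸ rookCount (Q ∷ʳ q)) * y ^ n))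
               (columnChoices n))
    placement-*x hs n Q len = begin
      weight R w hs Q * (x ^ (length hs ∸ rookCount Q) * y ^ n) * x
        ≈⟨ *-assoc _ _ _ ⟩
      weight R w hs Q * (x ^ (length hs ∸ rookCount Q) * y ^ n * x)
        ≈⟨ *-congˡ (x*column r n rookCount≤ (λ t → rooksAtOrAbove-reverse≤rookCount t Q)) ⟩
      weight R w hs Q * sum (map (λ q → columnWeight w (suc (length hs)) r n q * E q) (columnChoices n))
        ≈⟨ sum-distribˡ _ _ (columnChoices n) ⟩
      sum (map (λ q → weight R w hs Q * (columnWeight w (suc (length hs)) r n q * E q)) (columnChoices n))
        ≈⟨ sum-cong (columnChoices n) (λ q → trans (sym (*-assoc _ _ _))
             (*-cong (sym (weightFrom-∷ʳ w n q 1 [] hs Q len))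
                     (reflexive (≡.cong (λ e → x ^ (suc (length hs) ∸ e) * y ^ n) (≡.sym (rookCount-∷ʳ Q q)))))) ⟩
      sum (map (λ q → weight R w (hs ∷ʳ n) (Q ∷ʳ q) * (x ^ (suc (length hs) ∸ rookCount (Q ∷ʳ q)) * y ^ n))
               (columnChoices n)) ∎
      where
      r : ℕ → ℕ
      r t = rooksAtOrAbove t (Q ʳ++ [])
      E : Maybe ℕ → Carrier
      E q = x ^ (suc (length hs) ∸ (rookCount (q ∷ []) ℕ.+ rookCount Q)) * y ^ n
      rookCount≤ : rookCount Q ≤ length hs
      rookCount≤ = ℕₚ.≤-trans (rookCount≤length Q) (ℕₚ.≤-reflexive len)

    normalForm-*x : ∀ hs m n → length hs ≡ m → normalForm hs m n * x ≈ normalForm (hs ∷ʳ n) (suc m) n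
    normalForm-*x hs m n ≡.refl = begin
      normalForm hs m n * x
        ≈⟨ sum-distribʳ x _ (placements hs) ⟩
      sum (map (λ Q → weight R w hs Q * (x ^ (m ∸ rookCount Q) * y ^ n) * x) (placements hs))
        ≈⟨ sum-congᴬ (All.map (placement-*x hs n _) (placements-length hs)) ⟩
      sum (map (λ Q → sum (map (λ q → weight R w (hs ∷ʳ n) (Q ∷ʳ q) * (x ^ (suc m ∸ rookCount (Q ∷ʳ q)) * y ^ n))
                              (columnChoices n)))
               (placements hs))
        ≈⟨ sym (sum-placements-∷ʳ n hs _) ⟩
      normalForm (hs ∷ʳ n) (suc m) n ∎

    evalWord≈normalForm : ∀ {α} → Reverse α → evalWord R x y α ≈ normalForm (heights α) (countX α) (countY α)
    evalWord≈normalForm [] = sym (trans (+-identityʳ _) (trans (*-identityˡ _) (*-identityˡ _)))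
    evalWord≈normalForm (β ∶ β′ ∶ʳ X)
      rewrite heights-∷ʳ-X β | countX-∷ʳ-X β | countY-∷ʳ-X β = begin
        evalWord R x y (β ∷ʳ X)         ≈⟨ evalWord-∷ʳ x y β X ⟩
        evalWord R x y β * x            ≈⟨ *-congʳ (evalWord≈normalForm β′) ⟩
        normalForm hs (countX β) n * x  ≈⟨ normalForm-*x hs (countX β) n (length-heightsFrom 0 β) ⟩
        normalForm (hs ∷ʳ n) (suc (countX β)) n ∎
      where
      hs = heights β
      n  = countY β
    evalWord≈normalForm (β ∶ β′ ∶ʳ Y)
      rewrite heightsFrom-∷ʳ-Y 0 β | countX-∷ʳ-Y β | countY-∷ʳ-Y β = begin
        evalWord R x y (β ∷ʳ Y)                          ≈⟨ evalWord-∷ʳ x y β Y ⟩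
        evalWord R x y β * y                             ≈⟨ *-congʳ (evalWord≈normalForm β′) ⟩
        normalForm (heights β) (countX β) (countY β) * y ≈⟨ normalForm-*y (heights β) (countX β) (countY β) ⟩
        normalForm (heights β) (countX β) (suc (countY β)) ∎

    fileNumbers≈normalForm : ∀ hs m n → length hs ≡ m →
      sum (map (λ k → fileNumber R w k hs * x ^ (m ∸ k) * y ^ n) (upTo (suc m))) ≈ normalForm hs m n
    fileNumbers≈normalForm hs m n len =
      trans (sum-cong (upTo (suc m)) (λ k → *-assoc _ _ _))
            (sum-by-key rookCount (weight R w hs) (λ k → x ^ (m ∸ k) * y ^ n) (suc m) (placements hs)
              (All.map (λ {Q} lenQ → s≤s (ℕₚ.≤-trans (rookCount≤length Q) (ℕₚ.≤-reflexive (≡.trans lenQ len))))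
                       (placements-length hs)))

theorem4p4 : ∀ {c ℓ} (R : Ring c ℓ) → let open Ring R in
    (x y : Carrier) (w : ℕ → ℕ → Carrier) →
    (∀ s t s′ t′ → w s t * w s′ t′ ≈ w s′ t′ * w s t) →
    y * x ≈ w 1 1 * x * y + y →
    (∀ s t → x * w s t ≈ w (suc s) t * x) →
    (∀ s t → y * w s t ≈ w s (suc t) * y) →
    (α : Word) →
    evalWord R x y α ≈
      sumR R (map (λ k → fileNumber R w k (heights α) * pow R x (countX α ∸ k) * pow R y (countY α))
                  (upTo (suc (countX α))))
theorem4p4 R x y w w-comm y*x x*w y*w α =
  trans (evalWord≈normalForm (reverseView α))
        (sym (fileNumbers≈normalForm (heights α) (countX α) (countY α) (length-heightsFrom 0 α)))
  where
  open Ring R using (trans; sym)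
  open Normalisation R x y w w-comm y*x x*w y*w
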